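{- Given elements $a$ and $b$ of an $\omega$-complete effect monoid $M$, if $a\cdot b=0$ then $a\cdot\lceil b\rceil=0$.
   Context: An effect algebra is a set $E$ with an element $0$, a partial binary operation $a+b$ (the partial sum), and a total complement $a\mapsto a^\perp$, such that: the sum is commutative and associative wherever defined, $a+0=a$, $a^\perp$ is the unique element with $a+a^\perp=1$ where $1:=0^\perp$, and $a+1$ defined implies $a=0$. The order is $a\le b$ iff $b=a+c$ for some $c$. An effect monoid is an effect algebra with an associative total multiplication $\cdot$ with unit $1$ which distributes over the partial sum on both sides. It is $\omega$-complete if every increasing sequence has a supremum. For a family $(x_i)$, the infinite sum $\sum_i x_i$ is the supremum of the finite partial sums (when these are all defined and the supremum exists). The ceiling of $b$ is $\lceil b\rceil=\sum_{n=0}^\infty b\cdot(b^\perp)^n$, which exists in an $\omega$-complete effect monoid. -}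

module Defs where

open import Level using (Level; suc; _⊔_)
open import Data.Nat using (ℕ; zero) renaming (suc to sucℕ)
open import Data.Maybe using (Maybe; just)
open import Data.Product using (Σ; ∃; _×_; _,_)
open import Relation.Binary.PropositionalEquality using (_≡_)

-- An effect algebra.  The partial sum is a Maybe-valued operation:
-- a ⊕ b ≡ just c  means  "a + b is defined and equals c".
record EffectAlgebra (ℓ : Level) : Set (suc ℓ) where
  field
    Carrier : Set ℓ
    𝟘       : Carrier
    _⊕_     : Carrier → Carrier → Maybe Carrier
    _⊥      : Carrier → Carrier

  𝟙 : Carrier
  𝟙 = 𝟘 ⊥

  field
    ⊕-comm  : ∀ a b → a ⊕ b ≡ b ⊕ a
    ⊕-assoc : ∀ a b c d e → a ⊕ b ≡ just d → d ⊕ c ≡ just e →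
              Σ Carrier λ f → (b ⊕ c ≡ just f) × (a ⊕ f ≡ just e)
    ⊕-identity : ∀ a → a ⊕ 𝟘 ≡ just a
    ⊥-sum      : ∀ a → a ⊕ (a ⊥) ≡ just 𝟙
    ⊥-unique   : ∀ a b → a ⊕ b ≡ just 𝟙 → b ≡ a ⊥
    zero-one   : ∀ a c → a ⊕ 𝟙 ≡ just c → a ≡ 𝟘

  _≤_ : Carrier → Carrier → Set ℓ
  a ≤ b = ∃ λ c → a ⊕ c ≡ just b

  Increasing : (ℕ → Carrier) → Set ℓ
  Increasing s = ∀ n → s n ≤ s (sucℕ n)

  IsUpperBound : (ℕ → Carrier) → Carrier → Set ℓ
  IsUpperBound s u = ∀ n → s n ≤ u

  IsSup : (ℕ → Carrier) → Carrier → Set ℓ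
  IsSup s u = IsUpperBound s u × (∀ v → IsUpperBound s v → u ≤ v)

  -- PartialSum x n s : the finite sum x 0 + ... + x (n-1) is defined and equals s
  data PartialSum (x : ℕ → Carrier) : ℕ → Carrier → Set ℓ where
    ps-zero : PartialSum x zero 𝟘
    ps-suc  : ∀ {n s t} → PartialSum x n s → s ⊕ x n ≡ just t →
              PartialSum x (sucℕ n) t

  IsInfSum : (ℕ → Carrier) → Carrier → Set ℓ
  IsInfSum x c = Σ (ℕ → Carrier) λ p → (∀ n → PartialSum x n (p n)) × IsSup p c

record EffectMonoid (ℓ : Level) : Set (suc ℓ) where
  field
    effectAlgebra : EffectAlgebra ℓ
  open EffectAlgebra effectAlgebra public
  field
    _·_     : Carrier → Carrier → Carrier
    ·-assoc : ∀ a b c → (a · b) · c ≡ a · (b · c)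
    ·-identityˡ : ∀ a → 𝟙 · a ≡ a
    ·-identityʳ : ∀ a → a · 𝟙 ≡ a
    ·-distribˡ : ∀ x a b c → a ⊕ b ≡ just c → (x · a) ⊕ (x · b) ≡ just (x · c)
    ·-distribʳ : ∀ x a b c → a ⊕ b ≡ just c → (a · x) ⊕ (b · x) ≡ just (c · x)

  _^_ : Carrier → ℕ → Carrier
  a ^ zero     = 𝟙
  a ^ sucℕ n   = a · (a ^ n)

  IsCeiling : Carrier → Carrier → Set ℓ
  IsCeiling b c = IsInfSum (λ n → b · ((b ⊥) ^ n)) c

record ωEffectMonoid (ℓ : Level) : Set (suc ℓ) where
  field
    effectMonoid : EffectMonoid ℓ
  open EffectMonoid effectMonoid public
  field
    ω-complete : ∀ (s : ℕ → Carrier) → Increasing s → Σ Carrier (IsSup s)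

module Submission where

-- Let c = ⌈b⌉ = Σₙ xₙ with xₙ = b·(b⊥)ⁿ, partial sums pₙ and
-- c = pₙ + dₙ.  Since a·b = 0 we get a·xₙ = 0, hence a·pₙ = 0, so the element
-- e := a·c equals a·dₙ for every n.  Splitting dₙ = a·dₙ + a⊥·dₙ shows e ≤ dₙ,
-- i.e. e lies below every "gap" c ⊖ pₙ.  A purely order-theoretic fact about
-- effect algebras then forces e = 0: writing c = g + e, every pₙ ≤ g, so the
-- supremum c ≤ g, and c = c + h + e gives h + e = 0, hence e = 0.

open import Defs
open import Level using (Level)
open import Relation.Binary.PropositionalEquality
  using (_≡_; refl; sym; trans; cong; subst; module ≡-Reasoning)
open import Data.Maybe using (just)
open import Data.Maybe.Properties using (just-injective)
open import Data.Product using (Σ; _×_; _,_)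
open import Data.Nat using (ℕ; suc)

module EffectAlgebraProperties {ℓ : Level} (E : EffectAlgebra ℓ) where
  open EffectAlgebra E

  ⊕-identityˡ : ∀ x y → 𝟘 ⊕ x ≡ just y → y ≡ x
  ⊕-identityˡ x y p = just-injective (trans (sym p) (trans (⊕-comm 𝟘 x) (⊕-identity x)))

  ⊕-assocʳ : ∀ a b c d e → b ⊕ c ≡ just d → a ⊕ d ≡ just e →
             Σ Carrier λ f → (a ⊕ b ≡ just f) × (f ⊕ c ≡ just e)
  ⊕-assocʳ a b c d e p q with ⊕-assoc c b a d e (trans (⊕-comm c b) p) (trans (⊕-comm d a) q)
  ... | f , r , s = f , trans (⊕-comm a b) r , trans (⊕-comm f c) s

  -- Cancellation: a + b = a + c implies b = c.  Both b and c turn out to be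
  -- the orthocomplement of a + x⊥ (where x = a + b = a + c).
  ⊕-cancelˡ : ∀ a b c x → a ⊕ b ≡ just x → a ⊕ c ≡ just x → b ≡ c
  ⊕-cancelˡ a b c x p q
    with ⊕-assoc a b (x ⊥) x 𝟙 p (⊥-sum x) | ⊕-assoc a c (x ⊥) x 𝟙 q (⊥-sum x)
  ... | f , bx⊥≡f , af≡1 | g , cx⊥≡g , ag≡1
    with ⊥-unique a f af≡1 | ⊥-unique a g ag≡1
  ... | refl | refl
    with ⊕-assoc b (x ⊥) a (a ⊥) 𝟙 bx⊥≡f a⊥+a≡1 | ⊕-assoc c (x ⊥) a (a ⊥) 𝟙 cx⊥≡g a⊥+a≡1
    where a⊥+a≡1 = trans (⊕-comm (a ⊥) a) (⊥-sum a)
  ... | h , x⊥a≡h , bh≡1 | h′ , x⊥a≡h′ , ch′≡1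
    with just-injective (trans (sym x⊥a≡h) x⊥a≡h′)
  ... | refl = trans (⊥-unique h b (trans (⊕-comm h b) bh≡1))
                     (sym (⊥-unique h c (trans (⊕-comm h c) ch′≡1)))

  ⊕-positive : ∀ h e → h ⊕ e ≡ just 𝟘 → e ≡ 𝟘
  ⊕-positive h e p with ⊕-assoc h e 𝟙 𝟘 𝟙 p (trans (⊕-comm 𝟘 𝟙) (⊕-identity 𝟙))
  ... | f , e1≡f , _ = zero-one e f e1≡f

  below-own-part : ∀ c g h e → c ⊕ h ≡ just g → g ⊕ e ≡ just c → e ≡ 𝟘
  below-own-part c g h e ch≡g ge≡c with ⊕-assoc c h e g c ch≡g ge≡c
  ... | k , he≡k , ck≡c = ⊕-positive h e (trans he≡k (cong just k≡0))
    where k≡0 = ⊕-cancelˡ c k 𝟘 c ck≡c (⊕-identity c)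

  ≤-gap : ∀ x d u e g → x ⊕ d ≡ just u → e ≤ d → g ⊕ e ≡ just u → x ≤ g
  ≤-gap x d u e g xd≡u (f , ef≡d) ge≡u
    with ⊕-assocʳ x f e d u (trans (⊕-comm f e) ef≡d) xd≡u
  ... | g′ , xf≡g′ , g′e≡u = f , subst (λ z → x ⊕ f ≡ just z) g′≡g xf≡g′
    where g′≡g = ⊕-cancelˡ e g′ g u (trans (⊕-comm e g′) g′e≡u) (trans (⊕-comm e g) ge≡u)

  below-all-gaps : ∀ (p : ℕ → Carrier) c e → IsSup p c →
                   (∀ n → Σ Carrier λ d → (p n ⊕ d ≡ just c) × (e ≤ d)) → e ≡ 𝟘
  below-all-gaps p c e (_ , least) gaps
    with gaps 0
  ... | d₀ , p₀d₀≡c , (f₀ , ef₀≡d₀)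
    with ⊕-assocʳ (p 0) f₀ e d₀ c (trans (⊕-comm f₀ e) ef₀≡d₀) p₀d₀≡c
  ... | g , _ , ge≡c
    with least g (λ n → let (d , pd≡c , e≤d) = gaps n in ≤-gap (p n) d c e g pd≡c e≤d ge≡c)
  ... | h , ch≡g = below-own-part c g h e ch≡g ge≡c

module EffectMonoidProperties {ℓ : Level} (M : EffectMonoid ℓ) where
  open EffectMonoid M
  open EffectAlgebraProperties effectAlgebra

  -- 0 is absorbing on both sides: a·0 = a·0 + a·0, then cancel.
  ·-zeroʳ : ∀ a → a · 𝟘 ≡ 𝟘
  ·-zeroʳ a = ⊕-cancelˡ (a · 𝟘) (a · 𝟘) 𝟘 (a · 𝟘)
                (·-distribˡ a 𝟘 𝟘 𝟘 (⊕-identity 𝟘)) (⊕-identity (a · 𝟘))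

  ·-zeroˡ : ∀ a → 𝟘 · a ≡ 𝟘
  ·-zeroˡ a = ⊕-cancelˡ (𝟘 · a) (𝟘 · a) 𝟘 (𝟘 · a)
                (·-distribʳ a 𝟘 𝟘 𝟘 (⊕-identity 𝟘)) (⊕-identity (𝟘 · a))

  ·-absorbs-annihilated : ∀ a x d u → a · x ≡ 𝟘 → x ⊕ d ≡ just u → a · u ≡ a · d
  ·-absorbs-annihilated a x d u ax≡0 xd≡u =
    ⊕-identityˡ (a · d) (a · u) (subst (λ z → z ⊕ (a · d) ≡ just (a · u)) ax≡0
                                       (·-distribˡ a x d u xd≡u))

  ·-split : ∀ a d → (a · d) ⊕ ((a ⊥) · d) ≡ just d
  ·-split a d = subst (λ z → (a · d) ⊕ ((a ⊥) · d) ≡ just z) (·-identityˡ d)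
                      (·-distribʳ d a (a ⊥) 𝟙 (⊥-sum a))

  annihilates-partialSum : ∀ a (x : ℕ → Carrier) → (∀ n → a · x n ≡ 𝟘) →
                           ∀ {n s} → PartialSum x n s → a · s ≡ 𝟘
  annihilates-partialSum a x ax≡0 ps-zero = ·-zeroʳ a
  annihilates-partialSum a x ax≡0 {suc n} (ps-suc {s = s} {t = t} ps st≡t) = begin
    a · t      ≡⟨ ·-absorbs-annihilated a s (x n) t (annihilates-partialSum a x ax≡0 ps) st≡t ⟩
    a · x n    ≡⟨ ax≡0 n ⟩
    𝟘          ∎
    where open ≡-Reasoning

  -- ... and under infinite sums: with e = a·c and c = pₙ + dₙ we get e = a·dₙ ≤ dₙ,
  -- so the gap lemma applies.
  annihilates-infSum : ∀ a (x : ℕ → Carrier) c → (∀ n → a · x n ≡ 𝟘) →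
                       IsInfSum x c → a · c ≡ 𝟘
  annihilates-infSum a x c ax≡0 (p , ps , sup@(ub , _)) = below-all-gaps p c (a · c) sup gap
    where
    gap : ∀ n → Σ Carrier λ d → (p n ⊕ d ≡ just c) × ((a · c) ≤ d)
    gap n with ub n
    ... | d , pd≡c = d , pd≡c , ((a ⊥) · d , ac+a⊥d≡d)
      where
      ac≡ad : a · c ≡ a · d
      ac≡ad = ·-absorbs-annihilated a (p n) d c (annihilates-partialSum a x ax≡0 (ps n)) pd≡c

      ac+a⊥d≡d : (a · c) ⊕ ((a ⊥) · d) ≡ just d
      ac+a⊥d≡d = subst (λ z → z ⊕ ((a ⊥) · d) ≡ just d) (sym ac≡ad) (·-split a d)

proposition34 : ∀ {ℓ : Level} (M : ωEffectMonoid ℓ) → let open ωEffectMonoid M in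
    ∀ (a b ceilb : Carrier) → IsCeiling b ceilb → a · b ≡ 𝟘 → a · ceilb ≡ 𝟘
proposition34 M a b ceilb isCeiling ab≡0 =
  annihilates-infSum a summand ceilb a·summand≡0 isCeiling
  where
  open ωEffectMonoid M
  open EffectMonoidProperties effectMonoid

  summand : ℕ → Carrier
  summand n = b · ((b ⊥) ^ n)

  a·summand≡0 : ∀ n → a · summand n ≡ 𝟘
  a·summand≡0 n = begin
    a · (b · ((b ⊥) ^ n))   ≡⟨ sym (·-assoc a b _) ⟩
    (a · b) · ((b ⊥) ^ n)   ≡⟨ cong (_· ((b ⊥) ^ n)) ab≡0 ⟩
    𝟘 · ((b ⊥) ^ n)         ≡⟨ ·-zeroˡ _ ⟩
    𝟘                       ∎
    where open ≡-Reasoning
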